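{- Let $V\in\mathbb{R}_{\max}^{n\times p}$ have no row and no column identically $-\infty$, and assume each column of $V$ contains at least two finite entries. The following are equivalent: (1) there are disjoint dominions for the two players in the game $\Gamma$ associated with $V$; (2) there exist nonempty subsets $I,J\subset[n]$ with $I\cup J=[n]$, $I\cap J=\emptyset$, such that every column of $V$ either has support included in $I$ or has at least two finite entries in $J$ (with some columns having support included in $I$); (3) there exists a subset $K\subset[p]$ with $K\ne\emptyset$ and $K\ne[p]$ such that, denoting by $I_K$ the union of the supports of the columns of $V$ indexed by $K$, every column not in $K$ has at least two finite entries outside $I_K$. Moreover, in case (3), $I_K$ and its complement $[n]\setminus I_K$ are disjoint dominions of players Min and Max respectively.
   Context: $\mathbb{R}_{\max}=\mathbb{R}\cup\{ -\infty\}$; the support of a vector is the set of indices of its finite entries. Let $E=\{(i,k):V_{ik}\ne-\infty\}$. The game $\Gamma$: Min's states are $i\in[n]$, Max's states are pairs $(i,k)\in E$. At state $i$, Min chooses $k$ with $(i,k)\in E$, moving to $(i,k)$ (paying $-V_{ik}$ to Max); at $(i,k)$, Max chooses $j\in[n]$, $j\ne i$, with $(j,k)\in E$, moving to state $j$ (receiving $V_{jk}$); the game is played repeatedly. A policy of Min is a map choosing, at each $i$, an allowed $k$; a policy of Max chooses, at each $(i,k)$, an allowed $j$. A dominion of a player is a nonempty set $I\subset[n]$ such that this player has a policy ensuring that, whatever the other player does, every play starting from a state of $I$ only visits Min states in $I$. -}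

module Defs where

open import Data.Nat using (ℕ; suc)
open import Data.Fin using (Fin)
open import Data.Maybe using (Maybe; is-just)
open import Data.Bool using (Bool; T)
open import Data.Product using (Σ; ∃; ∃-syntax; _×_; proj₁)
open import Data.Sum using (_⊎_)
open import Relation.Nullary using (¬_)
open import Relation.Binary.PropositionalEquality using (_≡_; _≢_)

-- A matrix over the max-plus semiring R_max = R ∪ {-∞}: an entry is
-- 'just a' (finite, a ∈ A) or 'nothing' (= -∞).  Only the support
-- pattern matters for everything below, so the carrier A is arbitrary.
Mat : Set → ℕ → ℕ → Set
Mat A n p = Fin n → Fin p → Maybe A

Finite : {A : Set} → Maybe A → Set
Finite x = T (is-just x)

SubsetP : ℕ → Set₁
SubsetP n = Fin n → Set

BSub : ℕ → Set
BSub n = Fin n → Bool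

⟦_⟧ : {n : ℕ} → BSub n → SubsetP n
⟦ I ⟧ i = T (I i)

NonEmpty : {n : ℕ} → SubsetP n → Set
NonEmpty {n} I = ∃[ i ] I i

Disjoint : {n : ℕ} → SubsetP n → SubsetP n → Set
Disjoint {n} I J = (i : Fin n) → I i → J i → Data.Empty.⊥
  where import Data.Empty

module _ {A : Set} {n p : ℕ} (V : Mat A n p) where

  E : Fin n → Fin p → Set
  E i k = Finite (V i k)

  Supp : Fin p → SubsetP n
  Supp k i = E i k

  NoRowInfty : Set
  NoRowInfty = (i : Fin n) → ∃[ k ] E i k

  NoColInfty : Set
  NoColInfty = (k : Fin p) → ∃[ i ] E i k

  TwoFiniteIn : SubsetP n → Fin p → Set
  TwoFiniteIn S k = ∃[ i₁ ] ∃[ i₂ ] (i₁ ≢ i₂ × S i₁ × S i₂ × E i₁ k × E i₂ k)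

  EachColTwoFinite : Set
  EachColTwoFinite = (k : Fin p) → TwoFiniteIn (λ _ → Data.Unit.⊤) k
    where import Data.Unit

  MinPolicy : Set
  MinPolicy = (i : Fin n) → Σ (Fin p) (λ k → E i k)

  MaxPolicy : Set
  MaxPolicy = (i : Fin n) (k : Fin p) → E i k → Σ (Fin n) (λ j → j ≢ i × E j k)

  -- A play is described by the sequence of Min states i₀ i₁ … and the
  -- sequence of Max states (i₀,k₀) (i₁,k₁) …, with i 0 the starting state.
  PlayMin : MinPolicy → (ℕ → Fin n) → (ℕ → Fin p) → Set
  PlayMin σ i k = (t : ℕ) →
    (k t ≡ proj₁ (σ (i t))) × (i (suc t) ≢ i t) × E (i (suc t)) (k t)

  PlayMax : MaxPolicy → (ℕ → Fin n) → (ℕ → Fin p) → Set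
  PlayMax τ i k = (t : ℕ) →
    Σ (E (i t) (k t)) (λ e → i (suc t) ≡ proj₁ (τ (i t) (k t) e))

  MinDominion : SubsetP n → Set
  MinDominion I = NonEmpty I × Σ MinPolicy (λ σ →
    (i : ℕ → Fin n) (k : ℕ → Fin p) → I (i 0) → PlayMin σ i k →
    (t : ℕ) → I (i t))

  MaxDominion : SubsetP n → Set
  MaxDominion I = NonEmpty I × Σ MaxPolicy (λ τ →
    (i : ℕ → Fin n) (k : ℕ → Fin p) → I (i 0) → PlayMax τ i k →
    (t : ℕ) → I (i t))

  Cond1 : Set
  Cond1 = ∃[ I ] ∃[ J ] (MinDominion ⟦ I ⟧ × MaxDominion ⟦ J ⟧ × Disjoint ⟦ I ⟧ ⟦ J ⟧)

  Cond2 : Set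
  Cond2 = ∃[ I ] ∃[ J ] (NonEmpty ⟦ I ⟧ × NonEmpty ⟦ J ⟧
    × ((i : Fin n) → ⟦ I ⟧ i ⊎ ⟦ J ⟧ i) × Disjoint ⟦ I ⟧ ⟦ J ⟧
    × ((k : Fin p) → ((i : Fin n) → Supp k i → ⟦ I ⟧ i) ⊎ TwoFiniteIn ⟦ J ⟧ k)
    × (∃[ k ] ((i : Fin n) → Supp k i → ⟦ I ⟧ i)))

  I[_] : BSub p → SubsetP n
  I[ K ] i = ∃[ k ] (⟦ K ⟧ k × E i k)

  Cond3K : BSub p → Set
  Cond3K K = (∃[ k ] ⟦ K ⟧ k) × (∃[ k ] ¬ ⟦ K ⟧ k)
    × ((k : Fin p) → ¬ ⟦ K ⟧ k → TwoFiniteIn (λ i → ¬ I[ K ] i) k)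

  Cond3 : Set
  Cond3 = ∃[ K ] Cond3K K

{-# OPTIONS --safe #-}
-- A set of states is a dominion of a player exactly when it is nonempty and
-- closed under single moves against some policy: plays only chain moves, and
-- since every column has two finite entries and every row one, each single
-- move extends to a whole play.
--
-- If Min answers with a column of K whenever one is available, every finite
-- entry of that column lies in I_K, so I_K is closed for Min.  From a state
-- outside I_K Min can only choose columns outside K, and Max answers with one
-- of their two finite entries outside I_K, so ∁ I_K is closed for Max.  Conversely, for disjoint dominions I
-- of Min and J of Max, Max's policy moves from any finite entry in J of a
-- column to a second one in J, while all finite entries of the column Min
-- picks at a state of I lie in I ⊆ ∁ J; so (∁ J, J) witnesses (2).  Finally
-- (2) ⇒ (3) with K the set of columns supported in I, as then I_K ⊆ I.
module Submission where

open import Defs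
open import Data.Nat using (ℕ; zero; suc)
open import Data.Fin using (Fin)
open import Data.Fin.Properties using (any?; all?; _≟_)
open import Data.Product using (_×_; _,_; proj₁; proj₂; Σ; ∃-syntax)
open import Data.Sum using (_⊎_; inj₁; inj₂)
open import Data.Bool using (true; false; not; T)
open import Data.Empty using (⊥-elim)
open import Data.Maybe using (is-just)
open import Function.Base using (_∘_)
open import Function.Bundles using (_⇔_; mk⇔; Equivalence)
open import Relation.Nullary using (¬_; Dec; yes; no)
open import Relation.Nullary.Decidable
  using (isYes; isNo; toWitness; fromWitness; toWitnessFalse; fromWitnessFalse; _×-dec_; _→-dec_; T?)
open import Relation.Unary using (Decidable; _⊆_; _≐_; ∁)
open import Relation.Binary.PropositionalEquality using (_≢_; refl; sym; subst)

T-not : ∀ b → T (not b) ⇔ (¬ T b)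
T-not true  = mk⇔ (λ ()) (λ ¬t → ¬t _)
T-not false = mk⇔ (λ _ ()) _

T-not⊎T : ∀ b → T (not b) ⊎ T b
T-not⊎T true  = inj₂ _
T-not⊎T false = inj₁ _

module _ {A : Set} {n p : ℕ} (V : Mat A n p) where

  E? : ∀ i k → Dec (E V i k)
  E? i k = T? (is-just (V i k))

  otherEntry : ∀ {S : SubsetP n} {k} → TwoFiniteIn V S k →
               (x : Fin n) → ∃[ j ] (j ≢ x × S j × E V j k)
  otherEntry (i₁ , i₂ , i₁≢i₂ , s₁ , s₂ , e₁ , e₂) x with x ≟ i₁
  ... | yes refl = i₂ , i₁≢i₂ ∘ sym , s₂ , e₂
  ... | no x≢i₁  = i₁ , x≢i₁ ∘ sym , s₁ , e₁

  TwoFiniteIn-mono : ∀ {S T k} → S ⊆ T → TwoFiniteIn V S k → TwoFiniteIn V T k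
  TwoFiniteIn-mono S⊆T (i₁ , i₂ , i₁≢i₂ , s₁ , s₂ , e₁ , e₂) =
    i₁ , i₂ , i₁≢i₂ , S⊆T s₁ , S⊆T s₂ , e₁ , e₂

  MinClosed : MinPolicy V → SubsetP n → Set
  MinClosed σ I = ∀ {x j} → I x → j ≢ x → E V j (proj₁ (σ x)) → I j

  MaxClosed : MaxPolicy V → SubsetP n → Set
  MaxClosed τ I = ∀ {x k} (e : E V x k) → I x → I (proj₁ (τ x k e))

  MinConfines : MinPolicy V → SubsetP n → Set
  MinConfines σ I = (i : ℕ → Fin n) (k : ℕ → Fin p) → I (i 0) → PlayMin V σ i k →
    (t : ℕ) → I (i t)

  MaxConfines : MaxPolicy V → SubsetP n → Set
  MaxConfines τ I = (i : ℕ → Fin n) (k : ℕ → Fin p) → I (i 0) → PlayMax V τ i k →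
    (t : ℕ) → I (i t)

  minClosed⇒confines : ∀ {σ I} → MinClosed σ I → MinConfines σ I
  minClosed⇒confines closed i k i₀∈I play zero = i₀∈I
  minClosed⇒confines {σ} {I} closed i k i₀∈I play (suc t) with play t
  ... | k≡σ , i′≢i , e =
    closed (minClosed⇒confines {σ} {I} closed i k i₀∈I play t) i′≢i
           (subst (E V (i (suc t))) k≡σ e)

  maxClosed⇒confines : ∀ {τ I} → MaxClosed τ I → MaxConfines τ I
  maxClosed⇒confines closed i k i₀∈I play zero = i₀∈I
  maxClosed⇒confines {τ} {I} closed i k i₀∈I play (suc t) with play t
  ... | e , i′≡τ =
    subst I (sym i′≡τ) (closed e (maxClosed⇒confines {τ} {I} closed i k i₀∈I play t))

  minClosed⇒dominion : ∀ {I} → NonEmpty I → (σ : MinPolicy V) → MinClosed σ I → MinDominion V I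
  minClosed⇒dominion {I} I≠∅ σ closed = I≠∅ , σ , minClosed⇒confines {σ} {I} closed

  maxClosed⇒dominion : ∀ {I} → NonEmpty I → (τ : MaxPolicy V) → MaxClosed τ I → MaxDominion V I
  maxClosed⇒dominion {I} I≠∅ τ closed = I≠∅ , τ , maxClosed⇒confines {τ} {I} closed

  minConfines⇒closed : EachColTwoFinite V → ∀ {σ I} → MinConfines σ I → MinClosed σ I
  minConfines⇒closed two {σ} confines {x} {j} x∈I j≢x e =
    confines play (proj₁ ∘ σ ∘ play) x∈I consistent 1
    where
    move : (y : Fin n) → ∃[ z ] (z ≢ y × _ × E V z (proj₁ (σ y)))
    move y = otherEntry (two (proj₁ (σ y))) y
    play : ℕ → Fin n
    play zero          = x
    play (suc zero)    = j
    play (suc (suc t)) = proj₁ (move (play (suc t)))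
    consistent : PlayMin V σ play (proj₁ ∘ σ ∘ play)
    consistent zero    = refl , j≢x , e
    consistent (suc t) = let _ , y≢ , _ , f = move (play (suc t)) in refl , y≢ , f

  maxConfines⇒closed : NoRowInfty V → ∀ {τ I} → MaxConfines τ I → MaxClosed τ I
  maxConfines⇒closed row {τ} confines {x} {k} e x∈I =
    confines (proj₁ ∘ state) (proj₁ ∘ proj₂ ∘ state) x∈I consistent 1
    where
    state : ℕ → Σ (Fin n) λ y → Σ (Fin p) (E V y)
    state zero    = x , k , e
    state (suc t) = let y , l , f = state t ; z = proj₁ (τ y l f) in z , row z
    consistent : PlayMax V τ (proj₁ ∘ state) (proj₁ ∘ proj₂ ∘ state)
    consistent t = proj₂ (proj₂ (state t)) , refl

  minClosed⇒column⊆ : ∀ {σ I x} → MinClosed σ I → I x → Supp V (proj₁ (σ x)) ⊆ I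
  minClosed⇒column⊆ {x = x} closed x∈I {j} e with j ≟ x
  ... | yes refl = x∈I
  ... | no j≢x   = closed x∈I j≢x e

  minDominion-resp : ∀ {P Q} → P ≐ Q → MinDominion V P → MinDominion V Q
  minDominion-resp (P⊆Q , Q⊆P) ((i , i∈P) , σ , confines) =
    (i , P⊆Q i∈P) , σ , λ is ks i₀∈Q play t → P⊆Q (confines is ks (Q⊆P i₀∈Q) play t)

  maxDominion-resp : ∀ {P Q} → P ≐ Q → MaxDominion V P → MaxDominion V Q
  maxDominion-resp (P⊆Q , Q⊆P) ((i , i∈P) , τ , confines) =
    (i , P⊆Q i∈P) , τ , λ is ks i₀∈Q play t → P⊆Q (confines is ks (Q⊆P i₀∈Q) play t)

  cond1-of-decidable : ∀ {P} → Decidable P → MinDominion V P → MaxDominion V (∁ P) → Cond1 V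
  cond1-of-decidable P? minD maxD =
    isYes ∘ P? , isNo ∘ P? ,
    minDominion-resp (fromWitness , toWitness) minD ,
    maxDominion-resp (fromWitnessFalse , toWitnessFalse) maxD ,
    λ i i∈P i∈∁P → toWitnessFalse i∈∁P (toWitness i∈P)

  I[_]? : (K : BSub p) → Decidable (I[_] V K)
  I[ K ]? i = any? (λ k → T? (K k) ×-dec E? i k)

  answerInK : NoRowInfty V → BSub p → MinPolicy V
  answerInK row K x with I[ K ]? x
  ... | yes (k , _ , e) = k , e
  ... | no _            = row x

  answerInK-closed : (row : NoRowInfty V) (K : BSub p) → MinClosed (answerInK row K) (I[_] V K)
  answerInK-closed row K {x} x∈I _ e with I[ K ]? x
  ... | yes (k , k∈K , _) = k , k∈K , e
  ... | no x∉I            = ⊥-elim (x∉I x∈I)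

  EscapesI[_] : BSub p → Set
  EscapesI[ K ] = (k : Fin p) → ¬ ⟦ K ⟧ k → TwoFiniteIn V (∁ (I[_] V K)) k

  escape : EachColTwoFinite V → (K : BSub p) → EscapesI[ K ] → MaxPolicy V
  escape two K escapes x k _ with T? (K k)
  ... | yes _   = let j , j≢x , _ , f = otherEntry (two k) x in j , j≢x , f
  ... | no k∉K  = let j , j≢x , _ , f = otherEntry (escapes k k∉K) x in j , j≢x , f

  escape-closed : (two : EachColTwoFinite V) (K : BSub p) (escapes : EscapesI[ K ]) →
                  MaxClosed (escape two K escapes) (∁ (I[_] V K))
  escape-closed two K escapes {x} {k} e x∉I with T? (K k)
  ... | yes k∈K = ⊥-elim (x∉I (k , k∈K , e))
  ... | no k∉K  = proj₁ (proj₂ (proj₂ (otherEntry (escapes k k∉K) x)))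

  cond3K⇒dominions : NoRowInfty V → NoColInfty V → EachColTwoFinite V →
                     (K : BSub p) → Cond3K V K →
                     MinDominion V (I[_] V K) × MaxDominion V (∁ (I[_] V K))
  cond3K⇒dominions row col two K ((k , k∈K) , (l , l∉K) , escapes) =
    minClosed⇒dominion I≠∅ (answerInK row K) (answerInK-closed row K) ,
    maxClosed⇒dominion ∁I≠∅ (escape two K escapes) (escape-closed two K escapes)
    where
    I≠∅ : NonEmpty (I[_] V K)
    I≠∅ = let i , e = col k in i , k , k∈K , e
    ∁I≠∅ : NonEmpty (∁ (I[_] V K))
    ∁I≠∅ = let i , _ , _ , i∉I , _ = escapes l l∉K in i , i∉I

  cond3⇒cond1 : NoRowInfty V → NoColInfty V → EachColTwoFinite V → Cond3 V → Cond1 V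
  cond3⇒cond1 row col two (K , cond3K) =
    let minD , maxD = cond3K⇒dominions row col two K cond3K in
    cond1-of-decidable I[ K ]? minD maxD

  cond2⇒cond3 : NoRowInfty V → Cond2 V → Cond3 V
  cond2⇒cond3 row (I , J , _ , (j , j∈J) , _ , I∩J=∅ , classify , (k , k⊆I)) =
    K , (k , fromWitness k⊆I) , nonK , escapes
    where
    K : BSub p
    K l = isYes (all? (λ i → E? i l →-dec T? (I i)))
    I[K]⊆I : I[_] V K ⊆ ⟦ I ⟧
    I[K]⊆I (l , l∈K , e) = toWitness l∈K _ e
    J⊆∁I[K] : ⟦ J ⟧ ⊆ ∁ (I[_] V K)
    J⊆∁I[K] {i} i∈J i∈I[K] = I∩J=∅ i (I[K]⊆I i∈I[K]) i∈J
    nonK : ∃[ l ] ¬ ⟦ K ⟧ l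
    nonK = let l , e = row j in l , λ l∈K → I∩J=∅ j (toWitness l∈K j e) j∈J
    escapes : EscapesI[ K ]
    escapes l l∉K with classify l
    ... | inj₁ l⊆I    = ⊥-elim (l∉K (fromWitness l⊆I))
    ... | inj₂ twoInJ = TwoFiniteIn-mono J⊆∁I[K] twoInJ

  cond1⇒cond2 : NoRowInfty V → EachColTwoFinite V → Cond1 V → Cond2 V
  cond1⇒cond2 row two (I , J , ((i , i∈I) , σ , σ-confines) , (J≠∅ , τ , τ-confines) , I∩J=∅) =
    not ∘ J , J , (i , I⊆∁J i∈I) , J≠∅ , T-not⊎T ∘ J ,
    (λ j → Equivalence.to (T-not (J j))) ,
    classify , (proj₁ (σ i) , λ _ e → I⊆∁J (minClosed⇒column⊆ {σ} σ-closed i∈I e))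
    where
    σ-closed : MinClosed σ ⟦ I ⟧
    σ-closed = minConfines⇒closed two {σ} {⟦ I ⟧} σ-confines
    τ-closed : MaxClosed τ ⟦ J ⟧
    τ-closed = maxConfines⇒closed row {τ} {⟦ J ⟧} τ-confines
    I⊆∁J : ⟦ I ⟧ ⊆ ⟦ not ∘ J ⟧
    I⊆∁J {j} j∈I = Equivalence.from (T-not (J j)) (I∩J=∅ j j∈I)
    classify : (k : Fin p) → (∀ j → Supp V k j → ⟦ not ∘ J ⟧ j) ⊎ TwoFiniteIn V ⟦ J ⟧ k
    classify k with any? (λ j → E? j k ×-dec T? (J j))
    ... | no ¬meets =
      inj₁ λ j e → Equivalence.from (T-not (J j)) (λ j∈J → ¬meets (j , e , j∈J))
    ... | yes (j , e , j∈J) =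
      let j′ , j′≢j , e′ = τ j k e in inj₂ (j , j′ , j′≢j ∘ sym , j∈J , τ-closed e j∈J , e , e′)

propositionA3 : {A : Set} {n p : ℕ} (V : Mat A n p) →
    NoRowInfty V → NoColInfty V → EachColTwoFinite V →
    (Cond1 V ⇔ Cond2 V) × (Cond2 V ⇔ Cond3 V)
    × ((K : BSub p) → Cond3K V K →
         MinDominion V (I[_] V K) × MaxDominion V (λ i → ¬ I[_] V K i))
propositionA3 V row col two =
  mk⇔ (cond1⇒cond2 V row two) (cond3⇒cond1 V row col two ∘ cond2⇒cond3 V row) ,
  mk⇔ (cond2⇒cond3 V row) (cond1⇒cond2 V row two ∘ cond3⇒cond1 V row col two) ,
  cond3K⇒dominions V row col two
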